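{- Let $q$ be a power of an odd prime and let $m,d$ be positive integers with $q-1=md$ and $d$ even. Let $u,v\in\mathbb{F}_q^{\ast}$ be two distinct elements, both of multiplicative order $m$. Put $a=(v-u)/2$, $b=(u+v)/2$ and $f(x)=ax^{(q+1)/2}+bx\in\mathbb{F}_q[x]$. Then: (i) $f$ is a permutation polynomial of $\mathbb{F}_q$; (ii) the permutation of $\mathbb{F}_q$ induced by $f$ has cycle type $1+m^d$; (iii) the inverse permutation is induced by the binomial $a'x^{(q+1)/2}+b'x$, where $a'=(v^{ -1}-u^{ -1})/2$ and $b'=(u^{ -1}+v^{ -1})/2$.
   Context: The order of a nonzero element of $\mathbb{F}_q$ means its order in the multiplicative group $\mathbb{F}_q^{\ast}$. A cycle type written $1+m_0^{k_0}+m_1^{k_1}+\cdots$ means the permutation has exactly one fixed point and, besides it, its disjoint cycle decomposition consists of $k_0$ cycles of length $m_0$, $k_1$ cycles of length $m_1$, etc.; in particular $1+m^d$ means one fixed point and $d$ disjoint cycles each of length $m$. -}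

module Defs where

open import Level using (0ℓ)
open import Data.Nat using (ℕ; zero; suc; _<_)
open import Data.Fin using (Fin)
open import Data.Product using (_×_)
open import Relation.Binary.PropositionalEquality using (_≡_; _≢_)
open import Function.Bundles using (_↔_)
import Algebra.Structures as S

-- A finite field with exactly q elements, with propositional equality.
-- The multiplicative inverse is a total operation _⁻¹ (with 0⁻¹ = 0),
-- satisfying x * x⁻¹ = 1 for every nonzero x.
record FiniteField (q : ℕ) : Set₁ where
  infixl 6 _+_ _-_
  infixl 7 _*_
  infix  8 -_
  infix  9 _⁻¹
  field
    Carrier : Set
    _+_ _*_ : Carrier → Carrier → Carrier
    -_ _⁻¹  : Carrier → Carrier
    0# 1#   : Carrier
    isCommutativeRing : S.IsCommutativeRing {A = Carrier} _≡_ _+_ _*_ -_ 0# 1#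
    0≢1     : 0# ≢ 1#
    inverseʳ : ∀ x → x ≢ 0# → x * x ⁻¹ ≡ 1#
    inv-zero : 0# ⁻¹ ≡ 0#
    enumeration : Carrier ↔ Fin q

  _-_ : Carrier → Carrier → Carrier
  x - y = x + (- y)

  2# : Carrier
  2# = 1# + 1#

  _÷_ : Carrier → Carrier → Carrier
  x ÷ y = x * y ⁻¹

  _^_ : Carrier → ℕ → Carrier
  x ^ zero  = 1#
  x ^ suc n = x * (x ^ n)

  HasOrder : Carrier → ℕ → Set
  HasOrder x m = (0 < m) × (x ^ m ≡ 1#) × (∀ k → 0 < k → k < m → x ^ k ≢ 1#)

iter : {A : Set} → (A → A) → ℕ → A → A
iter f zero    x = x
iter f (suc n) x = f (iter f n x)

OnCycleOfLength : {A : Set} → (A → A) → ℕ → A → Set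
OnCycleOfLength f m x = (0 < m) × (iter f m x ≡ x) × (∀ k → 0 < k → k < m → iter f k x ≢ x)

open import Data.Nat using (_/_) renaming (_+_ to _+ℕ_)
open import Data.Product using (Σ)

module _ {q : ℕ} (F : FiniteField q) where
  open FiniteField F

  binomialMap : Carrier → Carrier → Carrier → Carrier
  binomialMap α β x = (α * (x ^ ((q +ℕ 1) / 2))) + (β * x)

  halfDiff : Carrier → Carrier → Carrier
  halfDiff x y = (x - y) ÷ 2#

  halfSum : Carrier → Carrier → Carrier
  halfSum x y = (x + y) ÷ 2#

-- the permutation f has cycle type 1 + m^d: exactly one fixed point, and every
-- other point lies on a cycle of length exactly m (so, when the carrier has
-- 1 + m d elements, there are exactly d such m-cycles)
HasCycleType1+m : {A : Set} → (A → A) → ℕ → Set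
HasCycleType1+m {A} f m =
  Σ A (λ x₀ → (f x₀ ≡ x₀) × (∀ y → f y ≡ y → y ≡ x₀) × (∀ y → y ≢ x₀ → OnCycleOfLength f m y))

module Submission where

-- Put E = (q - 1)/2. By Fermat, (x^E)² = 1 for x ≠ 0, so x^E = ±1 splits F* into the squares
-- and the non-squares, and f(x) = a x·x^E + b x equals (a + b) x = v x on the squares and
-- (b - a) x = u x on the non-squares. Since d is even, m divides E, so u^E = v^E = 1: multiplying
-- by u or v preserves each class. Hence every x ≠ 0 is mapped along w^k x for w ∈ {u, v} of
-- order m, giving cycles of length m; 0 is the only fixed point as u, v ≠ 1; and the binomial
-- built from u⁻¹, v⁻¹ undoes this class by class.

open import Level using (0ℓ)
open import Data.Nat as ℕ using (ℕ; zero; suc)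
import Data.Nat.Properties as ℕ
open import Data.Nat.DivMod using (m*n/n≡m)
open import Data.Nat.Divisibility using (divides)
open import Data.Nat.Tactic.RingSolver using (solve-∀)
open import Data.Bool using (if_then_else_)
open import Data.Fin using (Fin; zero; suc; punchIn)
open import Data.Fin.Properties using (punchInᵢ≢i; nonZeroIndex) renaming (_≟_ to _≟ᶠ_)
open import Data.Product using (_,_)
open import Data.Sum using (_⊎_; inj₁; inj₂)
open import Data.Empty using (⊥-elim)
open import Function using (id; _∘_; Inverse; _↔_; mk↔ₛ′)
open import Function.Bundles using (Bijection)
open import Function.Properties.Inverse using (↔-sym; ↔-trans; ↔⇒↣; ↔⇒⤖)
open import Algebra.Bundles using (CommutativeRing; CommutativeMonoid)
import Algebra.Properties.CommutativeMonoid.Sum as Summation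
import Algebra.Properties.CommutativeMonoid.Mult as Multiplication
import Algebra.Properties.Ring as RingProperties
open import Relation.Nullary using (Dec; yes; no; does)
open import Relation.Nullary.Decidable using (via-injection; dec-true; dec-false)
open import Relation.Binary.PropositionalEquality
  using (_≡_; _≢_; refl; sym; trans; cong; cong₂; subst; module ≡-Reasoning)
open import Defs

module CommutativeMonoidProperties {c ℓ} (M : CommutativeMonoid c ℓ) where
  open CommutativeMonoid M using (Carrier; _≈_; _∙_; ε; ∙-cong; identityˡ; setoid)
  open Summation M using (sum; sum-remove; sum-cong-≋; sum-replicate; sum-replicate-zero)
  open Multiplication M using (_×_)
  open import Relation.Binary.Reasoning.Setoid setoid

  ×-ε≈ε : ∀ n → n × ε ≈ ε
  ×-ε≈ε n = begin
    n × ε               ≈⟨ sum-replicate n ⟨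
    sum {n} (λ _ → ε)   ≈⟨ sum-replicate-zero n ⟩
    ε                   ∎

  sum-almostConstant : ∀ {n} (j : Fin n) (t : Fin n → Carrier) {a} →
                       t j ≈ ε → (∀ i → i ≢ j → t i ≈ a) → sum t ≈ (n ℕ.∸ 1) × a
  sum-almostConstant {suc n} j t {a} tj≈ε t≈a = begin
    sum t                       ≈⟨ sum-remove t ⟩
    t j ∙ sum (t ∘ punchIn j)   ≈⟨ ∙-cong tj≈ε (sum-cong-≋ (λ i → t≈a _ (punchInᵢ≢i j i))) ⟩
    ε ∙ sum {n} (λ _ → a)       ≈⟨ identityˡ _ ⟩
    sum {n} (λ _ → a)           ≈⟨ sum-replicate n ⟩
    n × a                       ∎

module FieldProperties {q : ℕ} (F : FiniteField q) where
  open FiniteField F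
  open CommutativeMonoidProperties using (×-ε≈ε; sum-almostConstant)

  commutativeRing : CommutativeRing 0ℓ 0ℓ
  commutativeRing = record { isCommutativeRing = isCommutativeRing }

  open CommutativeRing commutativeRing using
    ( +-comm; +-identityʳ; *-assoc; *-comm; *-identityˡ; *-identityʳ; distribˡ; zeroʳ
    ; ring; +-commutativeMonoid; *-commutativeMonoid )
  open RingProperties ring using (+-identityʳ-unique; +-inverseˡ-unique; //-rightDividesˡ; //-rightDividesʳ)
  open ≡-Reasoning

  module Additive where
    open Summation +-commutativeMonoid public
    open Multiplication +-commutativeMonoid public

  module Multiplicative where
    open Summation *-commutativeMonoid public
    open Multiplication *-commutativeMonoid public

  toFin : Carrier → Fin q
  toFin = Inverse.to enumeration

  fromFin : Fin q → Carrier
  fromFin = Inverse.from enumeration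

  fromFin-toFin : ∀ x → fromFin (toFin x) ≡ x
  fromFin-toFin = Inverse.strictlyInverseʳ enumeration

  fromFin-≢ : ∀ {i x} → i ≢ toFin x → fromFin i ≢ x
  fromFin-≢ {i} i≢toFin-x fromFin-i≡x =
    i≢toFin-x (trans (sym (Inverse.strictlyInverseˡ enumeration i)) (cong toFin fromFin-i≡x))

  _≟_ : (x y : Carrier) → Dec (x ≡ y)
  _≟_ = via-injection (↔⇒↣ enumeration) _≟ᶠ_

  inverseˡ : ∀ x → x ≢ 0# → x ⁻¹ * x ≡ 1#
  inverseˡ x x≢0 = trans (*-comm (x ⁻¹) x) (inverseʳ x x≢0)

  x*y≡1⇒x*[y*z]≡z : ∀ {x y z} → x * y ≡ 1# → x * (y * z) ≡ z
  x*y≡1⇒x*[y*z]≡z {x} {y} {z} xy≡1 = trans (sym (*-assoc x y z)) (trans (cong (_* z) xy≡1) (*-identityˡ z))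

  x*y≡0⇒x≡0⊎y≡0 : ∀ {x y} → x * y ≡ 0# → x ≡ 0# ⊎ y ≡ 0#
  x*y≡0⇒x≡0⊎y≡0 {x} {y} xy≡0 with x ≟ 0#
  ... | yes x≡0 = inj₁ x≡0
  ... | no x≢0  = inj₂ (begin
    y                ≡⟨ sym (*-identityˡ y) ⟩
    1# * y           ≡⟨ cong (_* y) (inverseˡ x x≢0) ⟨
    (x ⁻¹ * x) * y   ≡⟨ *-assoc (x ⁻¹) x y ⟩
    x ⁻¹ * (x * y)   ≡⟨ cong (x ⁻¹ *_) xy≡0 ⟩
    x ⁻¹ * 0#        ≡⟨ zeroʳ (x ⁻¹) ⟩
    0#               ∎)

  *-≢0 : ∀ {x y} → x ≢ 0# → y ≢ 0# → x * y ≢ 0#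
  *-≢0 x≢0 y≢0 xy≡0 with x*y≡0⇒x≡0⊎y≡0 xy≡0
  ... | inj₁ x≡0 = x≢0 x≡0
  ... | inj₂ y≡0 = y≢0 y≡0

  x*y≡y⇒x≡1 : ∀ {x y} → y ≢ 0# → x * y ≡ y → x ≡ 1#
  x*y≡y⇒x≡1 {x} {y} y≢0 xy≡y = begin
    x                ≡⟨ *-identityʳ x ⟨
    x * 1#           ≡⟨ cong (x *_) (inverseʳ y y≢0) ⟨
    x * (y * y ⁻¹)   ≡⟨ *-assoc x y (y ⁻¹) ⟨
    (x * y) * y ⁻¹   ≡⟨ cong (_* y ⁻¹) xy≡y ⟩
    y * y ⁻¹         ≡⟨ inverseʳ y y≢0 ⟩
    1#               ∎

  x*x≡1⇒x≡±1 : ∀ {x} → x * x ≡ 1# → x ≡ 1# ⊎ x ≡ - 1#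
  x*x≡1⇒x≡±1 {x} xx≡1 with (x + 1#) ≟ 0#
  ... | yes x+1≡0 = inj₂ (+-inverseˡ-unique x 1# x+1≡0)
  ... | no x+1≢0  = inj₁ (x*y≡y⇒x≡1 x+1≢0 (begin
    x * (x + 1#)       ≡⟨ distribˡ x x 1# ⟩
    x * x + x * 1#     ≡⟨ cong₂ _+_ xx≡1 (*-identityʳ x) ⟩
    1# + x             ≡⟨ +-comm 1# x ⟩
    x + 1#             ∎))

  ∏-≢0 : ∀ {n} (t : Fin n → Carrier) → (∀ i → t i ≢ 0#) → Multiplicative.sum t ≢ 0#
  ∏-≢0 {zero}  t t≢0 1≡0 = 0≢1 (sym 1≡0)
  ∏-≢0 {suc n} t t≢0 = *-≢0 (t≢0 zero) (∏-≢0 (t ∘ suc) (t≢0 ∘ suc))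

  ^≡× : ∀ x n → x ^ n ≡ n Multiplicative.× x
  ^≡× x zero    = refl
  ^≡× x (suc n) = cong (x *_) (^≡× x n)

  ^-distribˡ-+-* : ∀ x m n → x ^ (m ℕ.+ n) ≡ x ^ m * x ^ n
  ^-distribˡ-+-* x m n rewrite ^≡× x (m ℕ.+ n) | ^≡× x m | ^≡× x n = Multiplicative.×-homo-+ x m n

  ^-*-assoc : ∀ x m n → (x ^ m) ^ n ≡ x ^ (m ℕ.* n)
  ^-*-assoc x m n rewrite ^≡× (x ^ m) n | ^≡× x m | ^≡× x (m ℕ.* n) =
    trans (Multiplicative.×-assocˡ x n m) (cong (Multiplicative._× x) (ℕ.*-comm n m))

  ^-distribʳ-* : ∀ x y n → (x * y) ^ n ≡ x ^ n * y ^ n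
  ^-distribʳ-* x y n rewrite ^≡× (x * y) n | ^≡× x n | ^≡× y n = Multiplicative.×-distrib-+ x y n

  1^n≡1 : ∀ n → 1# ^ n ≡ 1#
  1^n≡1 n = trans (^≡× 1# n) (×-ε≈ε *-commutativeMonoid n)

  module _ {c ℓ} (M : CommutativeMonoid c ℓ) where
    open CommutativeMonoid M using (_≈_; reflexive) renaming (Carrier to A; sym to ≈-sym; trans to ≈-trans)
    open Summation M using (sum; sum-permute; sum-cong-≗)

    fieldSum : (Carrier → A) → A
    fieldSum φ = sum (φ ∘ fromFin)

    fieldSum-reindex : (σ : Carrier ↔ Carrier) (φ : Carrier → A) → fieldSum (φ ∘ Inverse.to σ) ≈ fieldSum φ
    fieldSum-reindex σ φ = ≈-sym (≈-trans (sum-permute (φ ∘ fromFin) π)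
      (reflexive (sum-cong-≗ (λ i → cong φ (fromFin-toFin (Inverse.to σ (fromFin i)))))))
      where
      π : Fin q ↔ Fin q
      π = ↔-trans (↔-sym enumeration) (↔-trans σ enumeration)

  ∑ ∏ : (Carrier → Carrier) → Carrier
  ∑ = fieldSum +-commutativeMonoid
  ∏ = fieldSum *-commutativeMonoid

  translation : Carrier → Carrier ↔ Carrier
  translation a = mk↔ₛ′ (_+ a) (_- a) (//-rightDividesˡ a) (//-rightDividesʳ a)

  scaling : (c : Carrier) → c ≢ 0# → Carrier ↔ Carrier
  scaling c c≢0 = mk↔ₛ′ (c *_) (c ⁻¹ *_)
    (λ _ → x*y≡1⇒x*[y*z]≡z (inverseʳ c c≢0)) (λ _ → x*y≡1⇒x*[y*z]≡z (inverseˡ c c≢0))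

  q×1≡0 : q Additive.× 1# ≡ 0#
  q×1≡0 = +-identityʳ-unique (∑ id) (q Additive.× 1#) (begin
    ∑ id + q Additive.× 1#       ≡⟨ cong (∑ id +_) (Additive.sum-replicate q) ⟨
    ∑ id + ∑ (λ _ → 1#)          ≡⟨ Additive.∑-distrib-+ fromFin (λ _ → 1#) ⟨
    ∑ (_+ 1#)                    ≡⟨ fieldSum-reindex +-commutativeMonoid (translation 1#) id ⟩
    ∑ id                         ∎)

  odd⇒2≢0 : ∀ n → q ≡ suc (n ℕ.+ n) → 2# ≢ 0#
  odd⇒2≢0 n q≡1+2n 2≡0 = 0≢1 (begin
    0#                                          ≡⟨ q×1≡0 ⟨
    q × 1#                                      ≡⟨ cong (_× 1#) q≡1+2n ⟩
    1# + (n ℕ.+ n) × 1#                         ≡⟨ cong (1# +_) (×-homo-+ 1# n n) ⟩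
    1# + (n × 1# + n × 1#)                      ≡⟨ cong (1# +_) (×-distrib-+ 1# 1# n) ⟨
    1# + n × 2#                                 ≡⟨ cong (λ t → 1# + n × t) 2≡0 ⟩
    1# + n × 0#                                 ≡⟨ cong (1# +_) (×-ε≈ε +-commutativeMonoid n) ⟩
    1# + 0#                                     ≡⟨ +-identityʳ 1# ⟩
    1#                                          ∎)
    where open Additive using (_×_; ×-homo-+; ×-distrib-+)

  ifZero : Carrier → Carrier → Carrier → Carrier
  ifZero x a b = if does (x ≟ 0#) then a else b

  ifZero-0 : ∀ a b → ifZero 0# a b ≡ a
  ifZero-0 a b rewrite dec-true (0# ≟ 0#) refl = refl

  ifZero-≢0 : ∀ {x} a b → x ≢ 0# → ifZero x a b ≡ b
  ifZero-≢0 {x} a b x≢0 rewrite dec-false (x ≟ 0#) x≢0 = refl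

  unitPart : Carrier → Carrier
  unitPart x = ifZero x 1# x

  unitPart≢0 : ∀ x → unitPart x ≢ 0#
  unitPart≢0 x with x ≟ 0#
  ... | yes refl = λ unitPart-0≡0 → 0≢1 (sym (trans (sym (ifZero-0 1# 0#)) unitPart-0≡0))
  ... | no x≢0   = λ unitPart-x≡0 → x≢0 (trans (sym (ifZero-≢0 1# x x≢0)) unitPart-x≡0)

  unitPart-scale : ∀ {c} → c ≢ 0# → ∀ x → unitPart (c * x) ≡ ifZero x 1# c * unitPart x
  unitPart-scale {c} c≢0 x with x ≟ 0#
  ... | yes refl = begin
    unitPart (c * 0#)   ≡⟨ cong unitPart (zeroʳ c) ⟩
    unitPart 0#         ≡⟨ ifZero-0 1# 0# ⟩
    1#                  ≡⟨ *-identityˡ 1# ⟨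
    1# * 1#             ≡⟨ cong₂ _*_ (ifZero-0 1# c) (ifZero-0 1# 0#) ⟨
    ifZero 0# 1# c * unitPart 0# ∎
  ... | no x≢0 = begin
    unitPart (c * x)    ≡⟨ ifZero-≢0 1# (c * x) (*-≢0 c≢0 x≢0) ⟩
    c * x               ≡⟨ cong₂ _*_ (ifZero-≢0 1# c x≢0) (ifZero-≢0 1# x x≢0) ⟨
    ifZero x 1# c * unitPart x ∎

  -- Replacing 0 by 1 makes the product over F nonzero, and reindexing it along x ↦ c x
  -- multiplies each of the q - 1 factors at x ≠ 0 by c.
  fermat : ∀ {c} → c ≢ 0# → c ^ (q ℕ.∸ 1) ≡ 1#
  fermat {c} c≢0 = x*y≡y⇒x≡1 (∏-≢0 (unitPart ∘ fromFin) (unitPart≢0 ∘ fromFin)) (begin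
    c ^ (q ℕ.∸ 1) * ∏ unitPart    ≡⟨ cong (_* ∏ unitPart) (trans (^≡× c (q ℕ.∸ 1)) (sym ∏χ≡c^[q-1])) ⟩
    ∏ χ * ∏ unitPart              ≡⟨ Multiplicative.∑-distrib-+ (χ ∘ fromFin) (unitPart ∘ fromFin) ⟨
    ∏ (λ x → χ x * unitPart x)    ≡⟨ Multiplicative.sum-cong-≗ (unitPart-scale c≢0 ∘ fromFin) ⟨
    ∏ (unitPart ∘ (c *_))         ≡⟨ fieldSum-reindex *-commutativeMonoid (scaling c c≢0) unitPart ⟩
    ∏ unitPart                    ∎)
    where
    χ : Carrier → Carrier
    χ x = ifZero x 1# c

    ∏χ≡c^[q-1] : ∏ χ ≡ (q ℕ.∸ 1) Multiplicative.× c
    ∏χ≡c^[q-1] = sum-almostConstant *-commutativeMonoid (toFin 0#) (χ ∘ fromFin)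
      (trans (cong χ (fromFin-toFin 0#)) (ifZero-0 1# c))
      (λ i i≢toFin-0 → ifZero-≢0 1# c (fromFin-≢ i≢toFin-0))

  ^-*-invariant : ∀ n {w} x → w ^ n ≡ 1# → (w * x) ^ n ≡ x ^ n
  ^-*-invariant n {w} x w^n≡1 =
    trans (^-distribʳ-* w x n) (trans (cong (_* x ^ n) w^n≡1) (*-identityˡ (x ^ n)))

  ⁻¹-^≡1 : ∀ n {w} → w ≢ 0# → w ^ n ≡ 1# → (w ⁻¹) ^ n ≡ 1#
  ⁻¹-^≡1 n {w} w≢0 w^n≡1 = begin
    (w ⁻¹) ^ n              ≡⟨ ^-*-invariant n (w ⁻¹) w^n≡1 ⟨
    (w * w ⁻¹) ^ n          ≡⟨ cong (_^ n) (inverseʳ w w≢0) ⟩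
    1# ^ n                  ≡⟨ 1^n≡1 n ⟩
    1#                      ∎

  order-^*≡1 : ∀ {w m} → HasOrder w m → ∀ n → w ^ (m ℕ.* n) ≡ 1#
  order-^*≡1 {w} {m} (_ , w^m≡1 , _) n = begin
    w ^ (m ℕ.* n)           ≡⟨ ^-*-assoc w m n ⟨
    (w ^ m) ^ n             ≡⟨ cong (_^ n) w^m≡1 ⟩
    1# ^ n                  ≡⟨ 1^n≡1 n ⟩
    1#                      ∎

  order1⇒≡1 : ∀ {w} → HasOrder w 1 → w ≡ 1#
  order1⇒≡1 {w} (_ , w¹≡1 , _) = trans (sym (*-identityʳ w)) w¹≡1

  distinct⇒1<order : ∀ {u v m} → HasOrder u m → HasOrder v m → u ≢ v → 1 ℕ.< m
  distinct⇒1<order {m = zero}          (() , _) _ _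
  distinct⇒1<order {m = suc zero}      ord-u ord-v u≢v =
    ⊥-elim (u≢v (trans (order1⇒≡1 ord-u) (sym (order1⇒≡1 ord-v))))
  distinct⇒1<order {m = suc (suc _)}   _ _ _ = ℕ.s≤s (ℕ.s≤s ℕ.z≤n)

  1<order⇒≢1 : ∀ {w m} → HasOrder w m → 1 ℕ.< m → w ≢ 1#
  1<order⇒≢1 {w} (_ , _ , minimal) 1<m w≡1 = minimal 1 (ℕ.s≤s ℕ.z≤n) 1<m (trans (*-identityʳ w) w≡1)

  iter-scaling : ∀ (f : Carrier → Carrier) w (P : Carrier → Set) →
                 (∀ {z} → P z → P (w * z)) → (∀ {z} → P z → f z ≡ w * z) →
                 ∀ {y} → P y → ∀ k → iter f k y ≡ w ^ k * y
  iter-scaling f w P P-closed f≡w* {y} Py = iter≡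
    where
    P-w^k*y : ∀ k → P (w ^ k * y)
    P-w^k*y zero    = subst P (sym (*-identityˡ y)) Py
    P-w^k*y (suc k) = subst P (sym (*-assoc w (w ^ k) y)) (P-closed (P-w^k*y k))

    iter≡ : ∀ k → iter f k y ≡ w ^ k * y
    iter≡ zero    = sym (*-identityˡ y)
    iter≡ (suc k) = begin
      f (iter f k y)      ≡⟨ cong f (iter≡ k) ⟩
      f (w ^ k * y)       ≡⟨ f≡w* (P-w^k*y k) ⟩
      w * (w ^ k * y)     ≡⟨ *-assoc w (w ^ k) y ⟨
      w ^ suc k * y       ∎

  order⇒onCycleOfLength : ∀ {f w m y} → HasOrder w m → y ≢ 0# →
                          (∀ k → iter f k y ≡ w ^ k * y) → OnCycleOfLength f m y
  order⇒onCycleOfLength {f} {w} {m} {y} (0<m , w^m≡1 , minimal) y≢0 iter≡ =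
    0<m , returns , λ k 0<k k<m iterᵏ≡y → minimal k 0<k k<m (x*y≡y⇒x≡1 y≢0 (trans (sym (iter≡ k)) iterᵏ≡y))
    where
    returns : iter f m y ≡ y
    returns = trans (iter≡ m) (trans (cong (_* y) w^m≡1) (*-identityˡ y))

module BinomialPermutation {q : ℕ} (F : FiniteField q) (E : ℕ) (q≡1+2E : q ≡ suc (E ℕ.+ E)) where
  open FiniteField F
  open FieldProperties F
  open CommutativeRing commutativeRing
    using (+-comm; +-assoc; *-assoc; *-comm; *-identityʳ; distribˡ; distribʳ; zeroʳ; ring)
  open RingProperties ring using (-‿distribˡ-*; -‿distribʳ-*; ⁻¹-anti-homo‿-; \\-leftDividesʳ)
  open ≡-Reasoning

  binomial : Carrier → Carrier → Carrier → Carrier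
  binomial u v = binomialMap F (halfDiff F v u) (halfSum F u v)

  [q+1]/2≡1+E : (q ℕ.+ 1) ℕ./ 2 ≡ suc E
  [q+1]/2≡1+E = begin
    (q ℕ.+ 1) ℕ./ 2               ≡⟨ cong (λ n → (n ℕ.+ 1) ℕ./ 2) q≡1+2E ⟩
    (suc (E ℕ.+ E) ℕ.+ 1) ℕ./ 2   ≡⟨ cong (ℕ._/ 2) (2n+2≡[n+1]*2 E) ⟩
    (suc E ℕ.* 2) ℕ./ 2           ≡⟨ m*n/n≡m (suc E) 2 ⟩
    suc E                         ∎
    where
    2n+2≡[n+1]*2 : ∀ n → suc (n ℕ.+ n) ℕ.+ 1 ≡ suc n ℕ.* 2
    2n+2≡[n+1]*2 = solve-∀

  quadraticCharacter : ∀ {x} → x ≢ 0# → x ^ E ≡ 1# ⊎ x ^ E ≡ - 1#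
  quadraticCharacter {x} x≢0 = x*x≡1⇒x≡±1 (begin
    x ^ E * x ^ E       ≡⟨ ^-distribˡ-+-* x E E ⟨
    x ^ (E ℕ.+ E)       ≡⟨ cong (λ n → x ^ (n ℕ.∸ 1)) q≡1+2E ⟨
    x ^ (q ℕ.∸ 1)       ≡⟨ fermat x≢0 ⟩
    1#                  ∎)

  [x+x]/2≡x : ∀ x → (x + x) ÷ 2# ≡ x
  [x+x]/2≡x x = begin
    (x + x) * 2# ⁻¹              ≡⟨ cong (λ t → (t + t) * 2# ⁻¹) (*-identityʳ x) ⟨
    (x * 1# + x * 1#) * 2# ⁻¹    ≡⟨ cong (_* 2# ⁻¹) (distribˡ x 1# 1#) ⟨
    x * 2# * 2# ⁻¹               ≡⟨ *-assoc x 2# (2# ⁻¹) ⟩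
    x * (2# * 2# ⁻¹)             ≡⟨ cong (x *_) (inverseʳ 2# (odd⇒2≢0 E q≡1+2E)) ⟩
    x * 1#                       ≡⟨ *-identityʳ x ⟩
    x                            ∎

  halfDiff+halfSum : ∀ x y → halfDiff F y x + halfSum F x y ≡ y
  halfDiff+halfSum x y = begin
    (y - x) * 2# ⁻¹ + (x + y) * 2# ⁻¹   ≡⟨ distribʳ (2# ⁻¹) (y - x) (x + y) ⟨
    ((y - x) + (x + y)) * 2# ⁻¹         ≡⟨ cong (_* 2# ⁻¹) (+-assoc y (- x) (x + y)) ⟩
    (y + (- x + (x + y))) * 2# ⁻¹       ≡⟨ cong (λ t → (y + t) * 2# ⁻¹) (\\-leftDividesʳ x y) ⟩
    (y + y) * 2# ⁻¹                     ≡⟨ [x+x]/2≡x y ⟩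
    y                                   ∎

  -‿halfDiff : ∀ x y → - halfDiff F x y ≡ halfDiff F y x
  -‿halfDiff x y = trans (-‿distribˡ-* (x - y) (2# ⁻¹)) (cong (_* 2# ⁻¹) (⁻¹-anti-homo‿- x y))

  binomialMap-onLevel : ∀ α β {x s} → x ^ E ≡ s → binomialMap F α β x ≡ (α * s + β) * x
  binomialMap-onLevel α β {x} {s} x^E≡s = begin
    α * x ^ ((q ℕ.+ 1) ℕ./ 2) + β * x   ≡⟨ cong (λ n → α * x ^ n + β * x) [q+1]/2≡1+E ⟩
    α * (x * x ^ E) + β * x             ≡⟨ cong (λ t → α * (x * t) + β * x) x^E≡s ⟩
    α * (x * s) + β * x                 ≡⟨ cong (λ t → α * t + β * x) (*-comm x s) ⟩
    α * (s * x) + β * x                 ≡⟨ cong (_+ β * x) (*-assoc α s x) ⟨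
    α * s * x + β * x                   ≡⟨ distribʳ x (α * s) β ⟨
    (α * s + β) * x                     ∎

  binomial-0 : ∀ u v → binomial u v 0# ≡ 0#
  binomial-0 u v = trans (binomialMap-onLevel _ _ refl) (zeroʳ _)

  binomial-square : ∀ {u v x} → x ^ E ≡ 1# → binomial u v x ≡ v * x
  binomial-square {u} {v} {x} x^E≡1 = trans (binomialMap-onLevel _ _ x^E≡1) (cong (_* x) (begin
    halfDiff F v u * 1# + halfSum F u v     ≡⟨ cong (_+ halfSum F u v) (*-identityʳ _) ⟩
    halfDiff F v u + halfSum F u v          ≡⟨ halfDiff+halfSum u v ⟩
    v                                       ∎))

  binomial-nonsquare : ∀ {u v x} → x ^ E ≡ - 1# → binomial u v x ≡ u * x
  binomial-nonsquare {u} {v} {x} x^E≡-1 = trans (binomialMap-onLevel _ _ x^E≡-1) (cong (_* x) (begin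
    halfDiff F v u * - 1# + halfSum F u v   ≡⟨ cong (_+ halfSum F u v) (-‿distribʳ-* _ 1#) ⟨
    - (halfDiff F v u * 1#) + halfSum F u v ≡⟨ cong (λ t → - t + halfSum F u v) (*-identityʳ _) ⟩
    - halfDiff F v u + halfSum F u v        ≡⟨ cong₂ _+_ (-‿halfDiff v u) (cong (_* 2# ⁻¹) (+-comm u v)) ⟩
    halfDiff F u v + halfSum F v u          ≡⟨ halfDiff+halfSum v u ⟩
    u                                       ∎))

  binomial-inverse : ∀ {u v u′ v′} → u ^ E ≡ 1# → v ^ E ≡ 1# → u′ * u ≡ 1# → v′ * v ≡ 1# →
                     ∀ x → binomial u′ v′ (binomial u v x) ≡ x
  binomial-inverse {u} {v} {u′} {v′} u^E≡1 v^E≡1 u′u≡1 v′v≡1 x with x ≟ 0#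
  ... | yes refl = trans (cong (binomial u′ v′) (binomial-0 u v)) (binomial-0 u′ v′)
  ... | no x≢0 with quadraticCharacter x≢0
  ... | inj₁ x^E≡1 = begin
    binomial u′ v′ (binomial u v x)   ≡⟨ cong (binomial u′ v′) (binomial-square x^E≡1) ⟩
    binomial u′ v′ (v * x)            ≡⟨ binomial-square (trans (^-*-invariant E x v^E≡1) x^E≡1) ⟩
    v′ * (v * x)                      ≡⟨ x*y≡1⇒x*[y*z]≡z v′v≡1 ⟩
    x                                 ∎
  ... | inj₂ x^E≡-1 = begin
    binomial u′ v′ (binomial u v x)   ≡⟨ cong (binomial u′ v′) (binomial-nonsquare x^E≡-1) ⟩
    binomial u′ v′ (u * x)            ≡⟨ binomial-nonsquare (trans (^-*-invariant E x u^E≡1) x^E≡-1) ⟩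
    u′ * (u * x)                      ≡⟨ x*y≡1⇒x*[y*z]≡z u′u≡1 ⟩
    x                                 ∎

  binomial-↔ : ∀ {u v} → u ≢ 0# → v ≢ 0# → u ^ E ≡ 1# → v ^ E ≡ 1# → Carrier ↔ Carrier
  binomial-↔ {u} {v} u≢0 v≢0 u^E≡1 v^E≡1 = mk↔ₛ′ (binomial u v) (binomial (u ⁻¹) (v ⁻¹))
    (binomial-inverse (⁻¹-^≡1 E u≢0 u^E≡1) (⁻¹-^≡1 E v≢0 v^E≡1) (inverseʳ u u≢0) (inverseʳ v v≢0))
    (binomial-inverse u^E≡1 v^E≡1 (inverseˡ u u≢0) (inverseˡ v v≢0))

  binomial-cycleType : ∀ {u v m} → HasOrder u m → HasOrder v m → u ≢ v → u ^ E ≡ 1# → v ^ E ≡ 1# →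
                       HasCycleType1+m (binomial u v) m
  binomial-cycleType {u} {v} {m} ord-u ord-v u≢v u^E≡1 v^E≡1 = 0# , binomial-0 u v , fixed⇒0 , onCycle
    where
    1<m : 1 ℕ.< m
    1<m = distinct⇒1<order ord-u ord-v u≢v

    u≢1 : u ≢ 1#
    u≢1 = 1<order⇒≢1 ord-u 1<m

    v≢1 : v ≢ 1#
    v≢1 = 1<order⇒≢1 ord-v 1<m

    fixed⇒0 : ∀ y → binomial u v y ≡ y → y ≡ 0#
    fixed⇒0 y fy≡y with y ≟ 0#
    ... | yes y≡0 = y≡0
    ... | no y≢0 with quadraticCharacter y≢0
    ... | inj₁ y^E≡1  = ⊥-elim (v≢1 (x*y≡y⇒x≡1 y≢0 (trans (sym (binomial-square y^E≡1)) fy≡y)))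
    ... | inj₂ y^E≡-1 = ⊥-elim (u≢1 (x*y≡y⇒x≡1 y≢0 (trans (sym (binomial-nonsquare y^E≡-1)) fy≡y)))

    orbit : ∀ {w t} → w ^ E ≡ 1# → (∀ {z} → z ^ E ≡ t → binomial u v z ≡ w * z) →
            ∀ {y} → y ^ E ≡ t → ∀ k → iter (binomial u v) k y ≡ w ^ k * y
    orbit {w} {t} w^E≡1 = iter-scaling (binomial u v) w (λ z → z ^ E ≡ t)
      (λ {z} z^E≡t → trans (^-*-invariant E z w^E≡1) z^E≡t)

    onCycle : ∀ y → y ≢ 0# → OnCycleOfLength (binomial u v) m y
    onCycle y y≢0 with quadraticCharacter y≢0
    ... | inj₁ y^E≡1  = order⇒onCycleOfLength ord-v y≢0 (orbit v^E≡1 binomial-square y^E≡1)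
    ... | inj₂ y^E≡-1 = order⇒onCycleOfLength ord-u y≢0 (orbit u^E≡1 binomial-nonsquare y^E≡-1)

q∸1≡m*[d*2]⇒q≡1+2md : ∀ q m d → .{{ℕ.NonZero q}} →
                      q ℕ.∸ 1 ≡ m ℕ.* (d ℕ.* 2) → q ≡ suc (m ℕ.* d ℕ.+ m ℕ.* d)
q∸1≡m*[d*2]⇒q≡1+2md (suc q) m d q≡m*[d*2] = cong suc (trans q≡m*[d*2] (m*[d*2]≡md+md m d))
  where
  m*[d*2]≡md+md : ∀ m d → m ℕ.* (d ℕ.* 2) ≡ m ℕ.* d ℕ.+ m ℕ.* d
  m*[d*2]≡md+md = solve-∀

open import Data.Nat using (ℕ; _*_; _+_; _≤_; _^_; _∸_)
open import Data.Nat.Primality using (Prime)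
open import Data.Nat.Divisibility using (_∣_)
open import Data.Product using (_×_)
open import Relation.Binary.PropositionalEquality using (_≡_; _≢_)
open import Relation.Nullary using (¬_)
open import Function.Definitions using (Bijective)
open FiniteField using (Carrier; 0#; _⁻¹; HasOrder)

mainTheorem1 : (q p k : ℕ) → Prime p → ¬ (2 ∣ p) → 1 ≤ k → q ≡ p ^ k →
    (F : FiniteField q) → (m d : ℕ) → 1 ≤ m → 1 ≤ d → q ∸ 1 ≡ m * d → 2 ∣ d →
    (u v : Carrier F) → u ≢ 0# F → v ≢ 0# F → u ≢ v →
    HasOrder F u m → HasOrder F v m →
    Bijective _≡_ _≡_ (binomialMap F (halfDiff F v u) (halfSum F u v))
    × HasCycleType1+m (binomialMap F (halfDiff F v u) (halfSum F u v)) m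
    × (∀ x → binomialMap F (halfDiff F (_⁻¹ F v) (_⁻¹ F u)) (halfSum F (_⁻¹ F u) (_⁻¹ F v))
               (binomialMap F (halfDiff F v u) (halfSum F u v) x) ≡ x)
    × (∀ x → binomialMap F (halfDiff F v u) (halfSum F u v)
               (binomialMap F (halfDiff F (_⁻¹ F v) (_⁻¹ F u)) (halfSum F (_⁻¹ F u) (_⁻¹ F v)) x) ≡ x)
mainTheorem1 q _ _ _ _ _ _ F m d _ _ q∸1≡m*d (divides d′ d≡d′*2) u v u≢0 v≢0 u≢v ord-u ord-v =
  Bijection.bijective (↔⇒⤖ f↔) ,
  binomial-cycleType ord-u ord-v u≢v (order-^*≡1 ord-u d′) (order-^*≡1 ord-v d′) ,
  Inverse.strictlyInverseʳ f↔ ,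
  Inverse.strictlyInverseˡ f↔
  where
  open FieldProperties F using (toFin; order-^*≡1)

  E : ℕ
  E = m * d′

  q≡1+2E : q ≡ suc (E + E)
  q≡1+2E = q∸1≡m*[d*2]⇒q≡1+2md q m d′ {{nonZeroIndex (toFin (0# F))}} (trans q∸1≡m*d (cong (m *_) d≡d′*2))

  open BinomialPermutation F E q≡1+2E using (binomial-↔; binomial-cycleType)

  f↔ : Carrier F ↔ Carrier F
  f↔ = binomial-↔ u≢0 v≢0 (order-^*≡1 ord-u d′) (order-^*≡1 ord-v d′)
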